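{- Let $\mathcal{R}$ be a commutative ring with unity, let $k>1$ be an integer, and let $\mathcal{I}_1,\ldots,\mathcal{I}_k$ be mutually co-maximal ideals of $\mathcal{R}$. Let $a_1,\ldots,a_k\in\mathcal{R}$ be such that for each $1\le i\le k$ with $\mathcal{I}_i\neq\mathcal{R}$, $a_i$ is a unit modulo $\mathcal{I}_i$. Then there exist $d_1,\ldots,d_k\in\mathcal{R}$ with $d_i\equiv a_i\bmod\mathcal{I}_i$ for $1\le i\le k$ and $d_1d_2\cdots d_k\equiv1\bmod\mathcal{I}_1\mathcal{I}_2\cdots\mathcal{I}_k$. -}

module Defs where

open import Level using (Level; _⊔_)
open import Algebra.Bundles using (CommutativeRing)
open import Data.Nat using (ℕ; zero; suc)
open import Data.Fin using (Fin; zero; suc)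
open import Data.List using (List; []; _∷_)
open import Data.List.Relation.Unary.All using (All)
open import Data.Product using (Σ; ∃; _×_; _,_; proj₁)
open import Relation.Binary.PropositionalEquality using (_≢_)

module _ {c ℓ : Level} (R : CommutativeRing c ℓ) where
  open CommutativeRing R hiding (zero)

  record Ideal (p : Level) : Set (c ⊔ ℓ ⊔ Level.suc p) where
    field
      Mem      : Carrier → Set p
      resp-≈   : ∀ {x y} → x ≈ y → Mem x → Mem y
      0∈       : Mem 0#
      +-closed : ∀ {x y} → Mem x → Mem y → Mem (x + y)
      ‐-closed : ∀ {x} → Mem x → Mem (- x)
      *-closed : ∀ r {x} → Mem x → Mem (r * x)

  open Ideal public

  IsWhole : ∀ {p} → Ideal p → Set (c ⊔ p)
  IsWhole I = ∀ x → Mem I x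

  _≡_mod_ : ∀ {p} → Carrier → Carrier → Ideal p → Set p
  x ≡ y mod I = Mem I (x - y)

  UnitMod : ∀ {p} → Carrier → Ideal p → Set (c ⊔ p)
  UnitMod a I = ∃ λ b → (a * b) ≡ 1# mod I

  CoMaximal : ∀ {p} → Ideal p → Ideal p → Set (c ⊔ ℓ ⊔ p)
  CoMaximal I J = ∃ λ x → ∃ λ y → Mem I x × Mem J y × (x + y ≈ 1#)

  MutuallyCoMaximal : ∀ {p k} → (Fin k → Ideal p) → Set (c ⊔ ℓ ⊔ p)
  MutuallyCoMaximal {k = k} I = (i j : Fin k) → i ≢ j → CoMaximal (I i) (I j)

  prodFin : ∀ {k} → (Fin k → Carrier) → Carrier
  prodFin {zero}  x = 1#
  prodFin {suc k} x = x zero * prodFin (λ i → x (suc i))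

  sumList : List Carrier → Carrier
  sumList []       = 0#
  sumList (x ∷ xs) = x + sumList xs

  ProdGen : ∀ {p k} → (Fin k → Ideal p) → Set (c ⊔ p)
  ProdGen {k = k} I = Σ (Fin k → Carrier) λ x → (i : Fin k) → Mem (I i) (x i)

  genValue : ∀ {p k} (I : Fin k → Ideal p) → ProdGen I → Carrier
  genValue I g = prodFin (proj₁ g)

  sumGens : ∀ {p k} (I : Fin k → Ideal p) → List (ProdGen I) → Carrier
  sumGens I []       = 0#
  sumGens I (g ∷ gs) = genValue I g + sumGens I gs

  -- Membership in the product ideal I₁⋯I_k: z is a finite sum of products
  -- x₁ x₂ ⋯ x_k with x_i ∈ I_i.
  MemProd : ∀ {p k} → (Fin k → Ideal p) → Carrier → Set (c ⊔ ℓ ⊔ p)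
  MemProd I z = ∃ λ gs → z ≈ sumGens I gs

  _≡_modProd_ : ∀ {p k} → Carrier → Carrier → (Fin k → Ideal p) → Set (c ⊔ ℓ ⊔ p)
  x ≡ y modProd I = MemProd I (x - y)

-- Chinese remainder basis elements e_i (e_i ≡ 1 mod I_i, e_i ∈ I_j for j ≠ i) turn any u into
-- 1 + e_i (u - 1), which is ≡ u mod I_i and ≡ 1 mod every other I_j.  Lift a_i and an inverse
-- b_i of a_i this way to f_i and g_i; then every f_i g_i is ≡ 1 modulo every I_m.  Since k > 1
-- the g_i can be regrouped into the d_i = f_i g′_i without disturbing d_i ≡ a_i mod I_i, and
-- ∏ d_i = ∏ f_i g_i lies in 1 + ⋂ I_m, which equals 1 + I_1 ⋯ I_k by co-maximality.
module Submission where

open import Defs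
open import Level using (Level)
open import Algebra.Bundles using (CommutativeRing)
open import Data.Nat using (ℕ; zero; suc; _<_; s≤s; z≤n)
open import Data.Fin using (Fin; zero; suc; _≟_)
open import Data.Fin.Properties using (suc-injective)
open import Data.List using ([]; _∷_; _++_; map)
open import Data.Product using (Σ; ∃; _×_; _,_; proj₁; proj₂)
open import Data.Sum using (_⊎_; inj₁; inj₂)
open import Relation.Nullary using (yes; no; contradiction)
open import Relation.Binary.PropositionalEquality using (_≢_) renaming (refl to ≡-refl)
import Relation.Binary.Reasoning.Setoid as SetoidReasoning
import Algebra.Properties.AbelianGroup as AbelianGroupProperties
import Algebra.Properties.CommutativeSemigroup as CommutativeSemigroupProperties
import Algebra.Properties.Ring as RingProperties

module IdealArithmetic {c ℓ : Level} (R : CommutativeRing c ℓ) where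
  open CommutativeRing R hiding (zero)
  open SetoidReasoning setoid
  open AbelianGroupProperties +-abelianGroup using (⁻¹-anti-homo‿-; ⁻¹-∙-comm; ε⁻¹≈ε; xyx⁻¹≈y)
  open RingProperties ring using (-‿distribˡ-*; -‿distribʳ-*)
  open CommutativeSemigroupProperties +-commutativeSemigroup using (interchange)
  open CommutativeSemigroupProperties *-commutativeSemigroup
    renaming (interchange to *-interchange)

  Π : ∀ {k} → (Fin k → Carrier) → Carrier
  Π = prodFin R

  infix 4 _≡_modulo_
  _≡_modulo_ : ∀ {p} → Carrier → Carrier → Ideal R p → Set p
  x ≡ y modulo J = _≡_mod_ R x y J

  x-0≈x : ∀ x → x - 0# ≈ x
  x-0≈x x = trans (+-congˡ ε⁻¹≈ε) (+-identityʳ x)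

  x+[y-x]≈y : ∀ x y → x + (y - x) ≈ y
  x+[y-x]≈y x y = trans (sym (+-assoc x y (- x))) (xyx⁻¹≈y x y)

  [x-y]+[y-z]≈x-z : ∀ x y z → (x - y) + (y - z) ≈ x - z
  [x-y]+[y-z]≈x-z x y z = begin
    (x - y) + (y - z)   ≈⟨ +-assoc x (- y) (y - z) ⟩
    x + (- y + (y - z)) ≈⟨ +-congˡ (+-assoc (- y) y (- z)) ⟨
    x + ((- y + y) - z) ≈⟨ +-congˡ (+-congʳ (-‿inverseˡ y)) ⟩
    x + (0# - z)        ≈⟨ +-congˡ (+-identityˡ (- z)) ⟩
    x - z               ∎

  [x-x′]+[y-y′]≈[x+y]-[x′+y′] : ∀ x x′ y y′ → (x - x′) + (y - y′) ≈ (x + y) - (x′ + y′)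
  [x-x′]+[y-y′]≈[x+y]-[x′+y′] x x′ y y′ = begin
    (x - x′) + (y - y′)    ≈⟨ interchange x (- x′) y (- y′) ⟩
    (x + y) + (- x′ - y′)  ≈⟨ +-congˡ (⁻¹-∙-comm x′ y′) ⟩
    (x + y) - (x′ + y′)    ∎

  [x-x′]y+x′[y-y′]≈xy-x′y′ : ∀ x x′ y y′ → (x - x′) * y + x′ * (y - y′) ≈ x * y - x′ * y′
  [x-x′]y+x′[y-y′]≈xy-x′y′ x x′ y y′ = begin
    (x - x′) * y + x′ * (y - y′)
      ≈⟨ +-cong (distribʳ y x (- x′)) (distribˡ x′ y (- y′)) ⟩
    (x * y + - x′ * y) + (x′ * y + x′ * - y′)
      ≈⟨ +-cong (+-congˡ (sym (-‿distribˡ-* x′ y))) (+-congˡ (sym (-‿distribʳ-* x′ y′))) ⟩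
    (x * y - x′ * y) + (x′ * y - x′ * y′)
      ≈⟨ [x-y]+[y-z]≈x-z (x * y) (x′ * y) (x′ * y′) ⟩
    x * y - x′ * y′
      ∎

  module _ {p : Level} (J : Ideal R p) where
    ≈⇒≡mod : ∀ {x y} → x ≈ y → x ≡ y modulo J
    ≈⇒≡mod {x} {y} x≈y = resp-≈ J (trans (sym (-‿inverseʳ y)) (+-congʳ (sym x≈y))) (0∈ J)

    ≡mod-refl : ∀ {x} → x ≡ x modulo J
    ≡mod-refl = ≈⇒≡mod refl

    ≡mod-sym : ∀ {x y} → x ≡ y modulo J → y ≡ x modulo J
    ≡mod-sym {x} {y} x≡y = resp-≈ J (⁻¹-anti-homo‿- x y) (‐-closed J x≡y)

    ≡mod-trans : ∀ {x y z} → x ≡ y modulo J → y ≡ z modulo J → x ≡ z modulo J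
    ≡mod-trans {x} {y} {z} x≡y y≡z = resp-≈ J ([x-y]+[y-z]≈x-z x y z) (+-closed J x≡y y≡z)

    ≡mod-≈-trans : ∀ {x y z} → x ≡ y modulo J → y ≈ z → x ≡ z modulo J
    ≡mod-≈-trans x≡y y≈z = ≡mod-trans x≡y (≈⇒≡mod y≈z)

    +-cong-mod : ∀ {x x′ y y′} → x ≡ x′ modulo J → y ≡ y′ modulo J → x + y ≡ x′ + y′ modulo J
    +-cong-mod {x} {x′} {y} {y′} x≡x′ y≡y′ =
      resp-≈ J ([x-x′]+[y-y′]≈[x+y]-[x′+y′] x x′ y y′) (+-closed J x≡x′ y≡y′)

    *-cong-mod : ∀ {x x′ y y′} → x ≡ x′ modulo J → y ≡ y′ modulo J → x * y ≡ x′ * y′ modulo J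
    *-cong-mod {x} {x′} {y} {y′} x≡x′ y≡y′ =
      resp-≈ J ([x-x′]y+x′[y-y′]≈xy-x′y′ x x′ y y′)
        (+-closed J (resp-≈ J (*-comm y (x - x′)) (*-closed J y x≡x′)) (*-closed J x′ y≡y′))

    Mem⇒≡0 : ∀ {x} → Mem J x → x ≡ 0# modulo J
    Mem⇒≡0 {x} x∈J = resp-≈ J (sym (x-0≈x x)) x∈J

    prodFin-≡1 : ∀ {k} (x : Fin k → Carrier) → (∀ i → x i ≡ 1# modulo J) → Π x ≡ 1# modulo J
    prodFin-≡1 {zero}  x x≡1 = ≡mod-refl
    prodFin-≡1 {suc k} x x≡1 =
      ≡mod-≈-trans (*-cong-mod (x≡1 zero) (prodFin-≡1 (λ i → x (suc i)) (λ i → x≡1 (suc i))))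
        (*-identityˡ 1#)

    prodFin-Mem : ∀ {k} (x : Fin k → Carrier) (j : Fin k) → Mem J (x j) → Mem J (Π x)
    prodFin-Mem x zero    xj∈J = resp-≈ J (*-comm _ _) (*-closed J (Π (λ i → x (suc i))) xj∈J)
    prodFin-Mem x (suc j) xj∈J = *-closed J (x zero) (prodFin-Mem (λ i → x (suc i)) j xj∈J)

  prodFin-* : ∀ {k} (x y : Fin k → Carrier) → Π (λ i → x i * y i) ≈ Π x * Π y
  prodFin-* {zero}  x y = sym (*-identityˡ 1#)
  prodFin-* {suc k} x y = begin
    (x zero * y zero) * Π (λ i → x (suc i) * y (suc i))
      ≈⟨ *-congˡ (prodFin-* (λ i → x (suc i)) (λ i → y (suc i))) ⟩
    (x zero * y zero) * (Π (λ i → x (suc i)) * Π (λ i → y (suc i)))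
      ≈⟨ *-interchange (x zero) (y zero) _ _ ⟩
    Π x * Π y
      ∎

  prodFin-1 : ∀ k → Π {k} (λ _ → 1#) ≈ 1#
  prodFin-1 zero    = refl
  prodFin-1 (suc k) = trans (*-identityˡ _) (prodFin-1 k)

  module _ {p : Level} {k : ℕ} (I : Fin (suc k) → Ideal R p) where
    private
      I′ : Fin k → Ideal R p
      I′ i = I (suc i)

    sumGens-++ : ∀ gs hs → sumGens R I (gs ++ hs) ≈ sumGens R I gs + sumGens R I hs
    sumGens-++ []       hs = sym (+-identityˡ _)
    sumGens-++ (g ∷ gs) hs = trans (+-congˡ (sumGens-++ gs hs)) (sym (+-assoc _ _ _))

    MemProd-resp : ∀ {x y} → x ≈ y → MemProd R I x → MemProd R I y
    MemProd-resp x≈y (gs , x≈Σgs) = gs , trans (sym x≈y) x≈Σgs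

    MemProd-+ : ∀ {x y} → MemProd R I x → MemProd R I y → MemProd R I (x + y)
    MemProd-+ (gs , x≈Σgs) (hs , y≈Σhs) =
      gs ++ hs , trans (+-cong x≈Σgs y≈Σhs) (sym (sumGens-++ gs hs))

    MemProd-prodFin : (x : Fin (suc k) → Carrier) → (∀ i → Mem (I i) (x i)) → MemProd R I (Π x)
    MemProd-prodFin x x∈I = (x , x∈I) ∷ [] , sym (+-identityʳ _)

    MemProd-* : ∀ {w z} → Mem (I zero) w → MemProd R I′ z → MemProd R I (w * z)
    MemProd-* {w} w∈I₀ (gs , z≈Σgs) = map cons gs , trans (*-congˡ z≈Σgs) (w*Σ≈Σcons gs)
      where
      cons : ProdGen R I′ → ProdGen R I
      cons (x , x∈I′) = (λ { zero → w ; (suc i) → x i }) , (λ { zero → w∈I₀ ; (suc i) → x∈I′ i })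
      w*Σ≈Σcons : ∀ gs → w * sumGens R I′ gs ≈ sumGens R I (map cons gs)
      w*Σ≈Σcons []       = zeroʳ w
      w*Σ≈Σcons (g ∷ gs) = trans (distribˡ w _ _) (+-congˡ (w*Σ≈Σcons gs))

  coMaximal⇒≡1 : ∀ {p} {I J : Ideal R p} → CoMaximal R I J → ∃ λ y → Mem J y × y ≡ 1# modulo I
  coMaximal⇒≡1 {I = I} (x , y , x∈I , y∈J , x+y≈1) =
    y , y∈J , ≡mod-≈-trans I (≡mod-trans I (≈⇒≡mod I (sym (+-identityˡ y)))
                                           (+-cong-mod I (≡mod-sym I (Mem⇒≡0 I x∈I)) (≡mod-refl I)))
                             x+y≈1

  module CoMaximalFamily {p : Level} {k : ℕ} (I : Fin k → Ideal R p) (cm : MutuallyCoMaximal R I) where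
    separator : Fin k → Fin k → Carrier
    separator i j with i ≟ j
    ... | yes _   = 1#
    ... | no  i≢j = proj₁ (coMaximal⇒≡1 {I = I i} {J = I j} (cm i j i≢j))

    separator≡1 : ∀ i j → separator i j ≡ 1# modulo I i
    separator≡1 i j with i ≟ j
    ... | yes _   = ≡mod-refl (I i)
    ... | no  i≢j = proj₂ (proj₂ (coMaximal⇒≡1 {I = I i} {J = I j} (cm i j i≢j)))

    separator∈ : ∀ i j → i ≢ j → Mem (I j) (separator i j)
    separator∈ i j i≢j with i ≟ j
    ... | yes i≡j = contradiction i≡j i≢j
    ... | no  i≢j′ = proj₁ (proj₂ (coMaximal⇒≡1 {I = I i} {J = I j} (cm i j i≢j′)))

    crtBasis : Fin k → Carrier
    crtBasis i = Π (separator i)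

    crtLift : Fin k → Carrier → Carrier
    crtLift i u = 1# + crtBasis i * (u - 1#)

    crtLift≡ : ∀ i u → crtLift i u ≡ u modulo I i
    crtLift≡ i u =
      ≡mod-≈-trans (I i)
        (+-cong-mod (I i) (≡mod-refl (I i))
          (*-cong-mod (I i) (prodFin-≡1 (I i) (separator i) (separator≡1 i)) (≡mod-refl (I i))))
        (trans (+-congˡ (*-identityˡ _)) (x+[y-x]≈y 1# u))

    crtLift≡1 : ∀ i j u → i ≢ j → crtLift i u ≡ 1# modulo I j
    crtLift≡1 i j u i≢j =
      ≡mod-≈-trans (I j)
        (+-cong-mod (I j) (≡mod-refl (I j))
          (*-cong-mod (I j) (Mem⇒≡0 (I j) (prodFin-Mem (I j) (separator i) j (separator∈ i j i≢j)))
            (≡mod-refl (I j))))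
        (trans (+-congˡ (zeroˡ _)) (+-identityʳ 1#))

  -- Q ∈ I₁ ⋯ I_k with 1 - Q ∈ I₀ splits z = (1 - Q) z + z Q into products from I₀ and I₁ ⋯ I_k.
  ⋂⊆∏ : ∀ {p n} (I : Fin (suc n) → Ideal R p) → MutuallyCoMaximal R I →
        ∀ z → (∀ i → Mem (I i) z) → MemProd R I z
  ⋂⊆∏ {n = zero}  I cm z z∈I = MemProd-resp I (*-identityʳ z) (MemProd-prodFin I (λ _ → z) z∈I)
  ⋂⊆∏ {n = suc n} I cm z z∈I =
    MemProd-resp I z≈ (MemProd-+ I (MemProd-* I 1-Q∈I₀ z∈∏I′) (MemProd-* I (z∈I zero) Q∈∏I′))
    where
    open CoMaximalFamily I cm
    I′ : Fin (suc n) → Ideal R _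
    I′ i = I (suc i)
    q : Fin (suc n) → Carrier
    q j = separator zero (suc j)
    Q : Carrier
    Q = Π q
    Q∈∏I′ : MemProd R I′ Q
    Q∈∏I′ = MemProd-prodFin I′ q (λ j → separator∈ zero (suc j) λ ())
    1-Q∈I₀ : Mem (I zero) (1# - Q)
    1-Q∈I₀ = ≡mod-sym (I zero) (prodFin-≡1 (I zero) q (λ j → separator≡1 zero (suc j)))
    z∈∏I′ : MemProd R I′ z
    z∈∏I′ = ⋂⊆∏ I′ (λ i j i≢j → cm (suc i) (suc j) (λ si≡sj → i≢j (suc-injective si≡sj)))
              z (λ i → z∈I (suc i))
    z≈ : (1# - Q) * z + z * Q ≈ z
    z≈ = begin
      (1# - Q) * z + z * Q   ≈⟨ +-congʳ (*-comm z _) ⟨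
      z * (1# - Q) + z * Q   ≈⟨ distribˡ z _ Q ⟨
      z * ((1# - Q) + Q)     ≈⟨ *-congˡ (trans (+-comm _ Q) (x+[y-x]≈y Q 1#)) ⟩
      z * 1#                 ≈⟨ *-identityʳ z ⟩
      z                      ∎

  regroup : ∀ {n} → (Fin (suc (suc n)) → Carrier) → Fin (suc (suc n)) → Carrier
  regroup g zero          = Π (λ j → g (suc j))
  regroup g (suc zero)    = g zero
  regroup g (suc (suc _)) = 1#

  regroup≡1 : ∀ {p n} (I : Fin (suc (suc n)) → Ideal R p) (g : Fin (suc (suc n)) → Carrier) →
              (∀ i j → i ≢ j → g i ≡ 1# modulo I j) → ∀ i → regroup g i ≡ 1# modulo I i
  regroup≡1 I g g≡1 zero          = prodFin-≡1 (I zero) _ (λ j → g≡1 (suc j) zero λ ())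
  regroup≡1 I g g≡1 (suc zero)    = g≡1 zero (suc zero) λ ()
  regroup≡1 I g g≡1 (suc (suc i)) = ≡mod-refl (I (suc (suc i)))

  prodFin-regroup : ∀ {n} (g : Fin (suc (suc n)) → Carrier) → Π (regroup g) ≈ Π g
  prodFin-regroup {n} g = begin
    Π (λ j → g (suc j)) * (g zero * Π {n} (λ _ → 1#)) ≈⟨ *-congˡ (*-congˡ (prodFin-1 n)) ⟩
    Π (λ j → g (suc j)) * (g zero * 1#)               ≈⟨ *-congˡ (*-identityʳ (g zero)) ⟩
    Π (λ j → g (suc j)) * g zero                      ≈⟨ *-comm _ (g zero) ⟩
    Π g                                               ∎

  inverseMod : ∀ {p} (J : Ideal R p) (a : Carrier) → IsWhole R J ⊎ UnitMod R a J →
               ∃ λ b → a * b ≡ 1# modulo J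
  inverseMod J a (inj₁ whole) = 1# , whole _
  inverseMod J a (inj₂ unit)  = unit

mainTheorem13 : {c ℓ p : Level} (R : CommutativeRing c ℓ) (k : ℕ) → 1 < k →
    (I : Fin k → Ideal R p) → MutuallyCoMaximal R I →
    (a : Fin k → CommutativeRing.Carrier R) →
    ((i : Fin k) → IsWhole R (I i) ⊎ UnitMod R (a i) (I i)) →
    Σ (Fin k → CommutativeRing.Carrier R) (λ d →
      ((i : Fin k) → _≡_mod_ R (d i) (a i) (I i)) ×
      _≡_modProd_ R (prodFin R d) (CommutativeRing.1# R) I)
mainTheorem13 R (suc (suc n)) (s≤s (s≤s z≤n)) I cm a unit = d , d≡a , ⋂⊆∏ I cm _ Πd≡1
  where
  open CommutativeRing R hiding (zero)
  open SetoidReasoning setoid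
  open IdealArithmetic R
  open CoMaximalFamily I cm

  b f g d : Fin (suc (suc n)) → Carrier
  b i = proj₁ (inverseMod (I i) (a i) (unit i))
  f i = crtLift i (a i)
  g i = crtLift i (b i)
  d i = f i * regroup g i

  g≡1 : ∀ i j → i ≢ j → g i ≡ 1# modulo I j
  g≡1 i j = crtLift≡1 i j (b i)

  d≡a : ∀ i → d i ≡ a i modulo I i
  d≡a i = ≡mod-≈-trans (I i) (*-cong-mod (I i) (crtLift≡ i (a i)) (regroup≡1 I g g≡1 i))
            (*-identityʳ (a i))

  fg≡1 : ∀ i m → f i * g i ≡ 1# modulo I m
  fg≡1 i m with i ≟ m
  ... | yes ≡-refl = ≡mod-trans (I i) (*-cong-mod (I i) (crtLift≡ i (a i)) (crtLift≡ i (b i)))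
                       (proj₂ (inverseMod (I i) (a i) (unit i)))
  ... | no  i≢m    = ≡mod-≈-trans (I m) (*-cong-mod (I m) (crtLift≡1 i m (a i) i≢m) (g≡1 i m i≢m))
                       (*-identityˡ 1#)

  Πd≈Πfg : Π d ≈ Π (λ i → f i * g i)
  Πd≈Πfg = begin
    Π d                     ≈⟨ prodFin-* f (regroup g) ⟩
    Π f * Π (regroup g)     ≈⟨ *-congˡ (prodFin-regroup g) ⟩
    Π f * Π g               ≈⟨ prodFin-* f g ⟨
    Π (λ i → f i * g i)     ∎

  Πd≡1 : ∀ m → Π d ≡ 1# modulo I m
  Πd≡1 m = ≡mod-trans (I m) (≈⇒≡mod (I m) Πd≈Πfg) (prodFin-≡1 (I m) _ (λ i → fg≡1 i m))
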